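{- Let $\mathsf{L'(IL)}=\mathsf{L(IL)}+\{(r_{id}),(p_{\supset_l})\}-\{(ref),(tra)\}$. For every formula $A$, every derivation of $A$ in $\mathsf{L'(IL)}$ (i.e. of the labeled sequent $\Rightarrow w:A$) is a labeled tree derivation.
   Context: Formulas: $A::=p\mid\bot\mid A\lor A\mid A\land A\mid A\supset A$. Labeled sequents are $\mathcal{R},\Gamma\Rightarrow\Delta$ with $\mathcal{R}$ a multiset of relational atoms $w\leq u$ and $\Gamma,\Delta$ multisets of labeled formulas $w:A$. $\mathsf{L(IL)}$ rules: $(id)$: $\mathcal{R},w\leq u,\Gamma,w:p\Rightarrow u:p,\Delta$; $(\bot_l)$: $\mathcal{R},w\leq u,\Gamma,w:\bot\Rightarrow\Delta$; $(\supset_r)$: from $\mathcal{R},w\leq u,\Gamma,u:A\Rightarrow u:B,\Delta$ infer $\mathcal{R},\Gamma\Rightarrow w:A\supset B,\Delta$ with $u$ fresh; $(\lor_l)$: from $\mathcal{R},\Gamma,w:A\Rightarrow\Delta$ and $\mathcal{R},\Gamma,w:B\Rightarrow\Delta$ infer $\mathcal{R},\Gamma,w:A\lor B\Rightarrow\Delta$; $(\lor_r)$: from $\mathcal{R},\Gamma\Rightarrow w:A,w:B,\Delta$ infer $\mathcal{R},\Gamma\Rightarrow w:A\lor B,\Delta$; $(\land_l)$: from $\mathcal{R},\Gamma,w:A,w:B\Rightarrow\Delta$ infer $\mathcal{R},\Gamma,w:A\land B\Rightarrow\Delta$; $(\land_r)$: from $\mathcal{R},\Gamma\Rightarrow w:A,\Delta$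 and $\mathcal{R},\Gamma\Rightarrow w:B,\Delta$ infer $\mathcal{R},\Gamma\Rightarrow w:A\land B,\Delta$; $(\supset_l)$: from $\mathcal{R},w\leq u,\Gamma,w:A\supset B,u:B\Rightarrow\Delta$ and $\mathcal{R},w\leq u,\Gamma,w:A\supset B\Rightarrow u:A,\Delta$ infer $\mathcal{R},w\leq u,\Gamma,w:A\supset B\Rightarrow\Delta$; $(ref)$: from $\mathcal{R},w\leq w,\Gamma\Rightarrow\Delta$ infer $\mathcal{R},\Gamma\Rightarrow\Delta$; $(tra)$: from $\mathcal{R},w\leq u,u\leq v,w\leq v,\Gamma\Rightarrow\Delta$ infer $\mathcal{R},w\leq u,u\leq v,\Gamma\Rightarrow\Delta$. $w\leadsto_{\mathcal{R}}u$ holds iff $w=u$ or there is a chain $w\leq v_1,\dots,v_n\leq u$ in $\mathcal{R}$ ($n\ge0$). Reachability rules: $(r_{id})$: $\mathcal{R},\Gamma,w:p\Rightarrow u:p,\Delta$ is an axiom if $w\leadsto_{\mathcal{R}}u$; $(p_{\supset_l})$: from $\mathcal{R},\Gamma,w:A\supset B\Rightarrow u:A,\Delta$ and $\mathcal{R},\Gamma,w:A\supset B,u:B\Rightarrow\Delta$ infer $\mathcal{R},\Gamma,w:A\supset B\Rightarrow\Delta$ if $w\leadsto_{\mathcal{R}}u$. A labeled tree sequent is a labeled sequent $\mathcal{R},\Gamma\Rightarrow\Delta$ such that the directed graph on the labels of $\mathcal{R}$ with edges $(w,u)$ for $w\leq u\in\mathcal{R}$ forms a tree, and all labels in $\Gamma,\Delta$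 occur in $\mathcal{R}$ (unless $\mathcal{R}$ is empty, in which case all labeled formulas in $\Gamma,\Delta$ share the same label). A labeled tree derivation is a derivation containing only labeled tree sequents. -}

module Defs where

open import Data.Nat using (ℕ; _≟_)
open import Data.List using (List; []; _∷_; _++_; filter; length)
open import Data.List.Membership.Propositional using (_∈_; _∉_)
open import Data.List.Relation.Unary.All using (All)
open import Data.List.Relation.Binary.Permutation.Propositional using (_↭_)
open import Data.Product using (Σ; _×_; _,_; ∃)
open import Data.Sum using (_⊎_)
open import Relation.Binary.PropositionalEquality using (_≡_; _≢_)

Var : Set
Var = ℕ

Label : Set
Label = ℕ

data Formula : Set where
  var  : Var → Formula
  ⊥'   : Formula
  _∨'_ : Formula → Formula → Formula
  _∧'_ : Formula → Formula → Formula
  _⊃_  : Formula → Formula → Formula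

record RelAtom : Set where
  constructor _≤'_
  field
    src : Label
    tgt : Label
open RelAtom public

record LFormula : Set where
  constructor _∶_
  field
    lab  : Label
    form : Formula
open LFormula public

-- multisets are represented by lists; derivations are closed under permutation
-- (constructor `perm` below), so only the multiset content matters.
record Sequent : Set where
  constructor ⟨_,_⇒_⟩
  field
    rel : List RelAtom
    ant : List LFormula
    suc : List LFormula
open Sequent public

relLabels : List RelAtom → List Label
relLabels [] = []
relLabels ((w ≤' u) ∷ R) = w ∷ u ∷ relLabels R

fmlLabels : List LFormula → List Label
fmlLabels [] = []
fmlLabels ((w ∶ A) ∷ Γ) = w ∷ fmlLabels Γ

seqLabels : Sequent → List Label
seqLabels ⟨ R , Γ ⇒ Δ ⟩ = relLabels R ++ fmlLabels Γ ++ fmlLabels Δ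

data _⇝[_]_ : Label → List RelAtom → Label → Set where
  ⇝-refl : ∀ {w R} → w ⇝[ R ] w
  ⇝-step : ∀ {w v u R} → (w ≤' v) ∈ R → v ⇝[ R ] u → w ⇝[ R ] u

data L′IL : Sequent → Set where
  perm  : ∀ {R R' Γ Γ' Δ Δ'} → R ↭ R' → Γ ↭ Γ' → Δ ↭ Δ' →
          L′IL ⟨ R , Γ ⇒ Δ ⟩ → L′IL ⟨ R' , Γ' ⇒ Δ' ⟩
  id    : ∀ {R Γ Δ w u p} →
          L′IL ⟨ (w ≤' u) ∷ R , (w ∶ var p) ∷ Γ ⇒ (u ∶ var p) ∷ Δ ⟩
  ⊥l    : ∀ {R Γ Δ w u} →
          L′IL ⟨ (w ≤' u) ∷ R , (w ∶ ⊥') ∷ Γ ⇒ Δ ⟩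
  ⊃r    : ∀ {R Γ Δ w u A B} →
          u ∉ seqLabels ⟨ R , Γ ⇒ (w ∶ (A ⊃ B)) ∷ Δ ⟩ →
          L′IL ⟨ (w ≤' u) ∷ R , (u ∶ A) ∷ Γ ⇒ (u ∶ B) ∷ Δ ⟩ →
          L′IL ⟨ R , Γ ⇒ (w ∶ (A ⊃ B)) ∷ Δ ⟩
  ∨l    : ∀ {R Γ Δ w A B} →
          L′IL ⟨ R , (w ∶ A) ∷ Γ ⇒ Δ ⟩ →
          L′IL ⟨ R , (w ∶ B) ∷ Γ ⇒ Δ ⟩ →
          L′IL ⟨ R , (w ∶ (A ∨' B)) ∷ Γ ⇒ Δ ⟩
  ∨r    : ∀ {R Γ Δ w A B} →
          L′IL ⟨ R , Γ ⇒ (w ∶ A) ∷ (w ∶ B) ∷ Δ ⟩ →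
          L′IL ⟨ R , Γ ⇒ (w ∶ (A ∨' B)) ∷ Δ ⟩
  ∧l    : ∀ {R Γ Δ w A B} →
          L′IL ⟨ R , (w ∶ A) ∷ (w ∶ B) ∷ Γ ⇒ Δ ⟩ →
          L′IL ⟨ R , (w ∶ (A ∧' B)) ∷ Γ ⇒ Δ ⟩
  ∧r    : ∀ {R Γ Δ w A B} →
          L′IL ⟨ R , Γ ⇒ (w ∶ A) ∷ Δ ⟩ →
          L′IL ⟨ R , Γ ⇒ (w ∶ B) ∷ Δ ⟩ →
          L′IL ⟨ R , Γ ⇒ (w ∶ (A ∧' B)) ∷ Δ ⟩
  ⊃l    : ∀ {R Γ Δ w u A B} →
          L′IL ⟨ (w ≤' u) ∷ R , (w ∶ (A ⊃ B)) ∷ (u ∶ B) ∷ Γ ⇒ Δ ⟩ →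
          L′IL ⟨ (w ≤' u) ∷ R , (w ∶ (A ⊃ B)) ∷ Γ ⇒ (u ∶ A) ∷ Δ ⟩ →
          L′IL ⟨ (w ≤' u) ∷ R , (w ∶ (A ⊃ B)) ∷ Γ ⇒ Δ ⟩
  r-id  : ∀ {R Γ Δ w u p} → w ⇝[ R ] u →
          L′IL ⟨ R , (w ∶ var p) ∷ Γ ⇒ (u ∶ var p) ∷ Δ ⟩
  p⊃l   : ∀ {R Γ Δ w u A B} → w ⇝[ R ] u →
          L′IL ⟨ R , (w ∶ (A ⊃ B)) ∷ Γ ⇒ (u ∶ A) ∷ Δ ⟩ →
          L′IL ⟨ R , (w ∶ (A ⊃ B)) ∷ (u ∶ B) ∷ Γ ⇒ Δ ⟩ →
          L′IL ⟨ R , (w ∶ (A ⊃ B)) ∷ Γ ⇒ Δ ⟩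

inDegree : Label → List RelAtom → ℕ
inDegree v R = length (filter (λ e → tgt e ≟ v) R)

-- the directed graph on the labels of R with edges (w,u) for w ≤ u ∈ R is a
-- (rooted, directed) tree: there is a root with in-degree 0, every other vertex
-- has in-degree exactly 1, and every vertex is reachable from the root.
IsTree : List RelAtom → Set
IsTree R = Σ Label λ r →
  (r ∈ relLabels R) ×
  (inDegree r R ≡ 0) ×
  (∀ v → v ∈ relLabels R → v ≢ r → inDegree v R ≡ 1) ×
  (∀ v → v ∈ relLabels R → r ⇝[ R ] v)

IsTreeSequent : Sequent → Set
IsTreeSequent ⟨ [] , Γ ⇒ Δ ⟩ =
  ∃ λ w → All (λ x → x ≡ w) (fmlLabels Γ ++ fmlLabels Δ)
IsTreeSequent ⟨ e ∷ R , Γ ⇒ Δ ⟩ =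
  IsTree (e ∷ R) ×
  All (λ x → x ∈ relLabels (e ∷ R)) (fmlLabels Γ ++ fmlLabels Δ)

Everywhere : (Sequent → Set) → ∀ {S} → L′IL S → Set
Everywhere P {S} (perm _ _ _ d) = P S × Everywhere P d
Everywhere P {S} id = P S
Everywhere P {S} ⊥l = P S
Everywhere P {S} (⊃r _ d) = P S × Everywhere P d
Everywhere P {S} (∨l d e) = P S × Everywhere P d × Everywhere P e
Everywhere P {S} (∨r d) = P S × Everywhere P d
Everywhere P {S} (∧l d) = P S × Everywhere P d
Everywhere P {S} (∧r d e) = P S × Everywhere P d × Everywhere P e
Everywhere P {S} (⊃l d e) = P S × Everywhere P d × Everywhere P e
Everywhere P {S} (r-id _) = P S
Everywhere P {S} (p⊃l _ d e) = P S × Everywhere P d × Everywhere P e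

IsTreeDerivation : ∀ {S} → L′IL S → Set
IsTreeDerivation = Everywhere IsTreeSequent

-- Being a labeled tree sequent is inherited by the premises of every rule of
-- L'(IL).  Apart from (⊃r), no rule changes the relational atoms, and every label
-- a premise adds to the formulas already occurs in the conclusion or in R: for
-- (⊃l) it is the target of an atom of R, for (p⊃l) it is reachable in R.  The rule
-- (⊃r) hangs a fresh leaf u below a label w of the conclusion, which keeps R a
-- tree.  Since ⇒ w : A is a tree sequent, induction on the derivation concludes.
module Submission where

open import Defs
open import Data.Nat using (_≟_; _+_)
open import Data.List using (List; []; _∷_; _++_; map; concatMap; length)
open import Data.List.Properties using (++-identityʳ; filter-accept; filter-reject; filter-none)
open import Data.List.Membership.Propositional using (_∈_; _∉_)
open import Data.List.Membership.Propositional.Properties using (∈-++⁺ˡ; ∈-++⁺ʳ; ∈-++⁻)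
open import Data.List.Relation.Unary.Any using (here; there)
open import Data.List.Relation.Unary.All as All using (All; []; _∷_; tabulate; lookup)
open import Data.List.Relation.Unary.All.Properties using (anti-mono)
open import Data.List.Relation.Binary.Subset.Propositional using (_⊆_)
open import Data.List.Relation.Binary.Subset.Propositional.Properties
  using (⊆-reflexive; ⊆-trans; ⊆-reflexive-↭; ⊆-respˡ-↭; xs⊆x∷xs; xs⊆xs++ys; ∷⁺ʳ; ∈-∷⁺ʳ; ++⁺; ++⁺ʳ; concatMap⁺)
open import Data.List.Relation.Binary.Permutation.Propositional using (_↭_; ↭-sym)
open import Data.List.Relation.Binary.Permutation.Propositional.Properties
  using (↭-empty-inv; ↭-length; filter-↭; shift) renaming (map⁺ to map⁺-↭)
open import Data.Product using (_,_)
open import Data.Sum using ([_,_]′)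
open import Data.Empty using (⊥-elim)
open import Function using (_∘_)
open import Relation.Binary.PropositionalEquality using (_≡_; _≢_; refl; sym; trans; cong; subst)

insert-⊆ : ∀ {A : Set} xs {ys zs : List A} {x} → x ∈ zs → xs ++ ys ⊆ zs → xs ++ x ∷ ys ⊆ zs
insert-⊆ xs {ys} {x = x} x∈zs xs++ys⊆zs =
  ⊆-respˡ-↭ (↭-sym (shift x xs ys)) (∈-∷⁺ʳ x∈zs xs++ys⊆zs)

endpoints : RelAtom → List Label
endpoints (w ≤' u) = w ∷ u ∷ []

relLabels-concatMap : ∀ R → relLabels R ≡ concatMap endpoints R
relLabels-concatMap [] = refl
relLabels-concatMap ((w ≤' u) ∷ R) = cong (λ L → w ∷ u ∷ L) (relLabels-concatMap R)

relLabels-mono : ∀ {R R'} → R ⊆ R' → relLabels R ⊆ relLabels R'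
relLabels-mono {R} {R'} R⊆R'
  rewrite relLabels-concatMap R | relLabels-concatMap R' = concatMap⁺ endpoints R⊆R'

tgt∈relLabels : ∀ {w u R} → (w ≤' u) ∈ R → u ∈ relLabels R
tgt∈relLabels {w} {u} e∈R = relLabels-mono {(w ≤' u) ∷ []} (∈-∷⁺ʳ e∈R (λ ())) (there (here refl))

fmlLabels-map : ∀ Γ → fmlLabels Γ ≡ map lab Γ
fmlLabels-map [] = refl
fmlLabels-map ((w ∶ A) ∷ Γ) = cong (w ∷_) (fmlLabels-map Γ)

fmlLabels-↭ : ∀ {Γ Γ'} → Γ ↭ Γ' → fmlLabels Γ ↭ fmlLabels Γ'
fmlLabels-↭ {Γ} {Γ'} Γ↭Γ'
  rewrite fmlLabels-map Γ | fmlLabels-map Γ' = map⁺-↭ lab Γ↭Γ'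

formulaLabels : Sequent → List Label
formulaLabels ⟨ _ , Γ ⇒ Δ ⟩ = fmlLabels Γ ++ fmlLabels Δ

⇝-mono : ∀ {R R' w u} → R ⊆ R' → w ⇝[ R ] u → w ⇝[ R' ] u
⇝-mono R⊆R' ⇝-refl = ⇝-refl
⇝-mono R⊆R' (⇝-step e∈R r) = ⇝-step (R⊆R' e∈R) (⇝-mono R⊆R' r)

⇝-snoc : ∀ {R w v u} → w ⇝[ R ] v → (v ≤' u) ∈ R → w ⇝[ R ] u
⇝-snoc ⇝-refl e∈R = ⇝-step e∈R ⇝-refl
⇝-snoc (⇝-step e'∈R r) e∈R = ⇝-step e'∈R (⇝-snoc r e∈R)

⇝-closed : ∀ {R w u} xs → w ⇝[ R ] u → w ∈ xs ++ relLabels R → u ∈ xs ++ relLabels R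
⇝-closed xs ⇝-refl w∈ = w∈
⇝-closed xs (⇝-step e∈R r) _ = ⇝-closed xs r (∈-++⁺ʳ xs (tgt∈relLabels e∈R))

inDegree-↭ : ∀ v {R R'} → R ↭ R' → inDegree v R ≡ inDegree v R'
inDegree-↭ v R↭R' = ↭-length (filter-↭ (λ e → tgt e ≟ v) R↭R')

inDegree-∉ : ∀ {v} R → v ∉ relLabels R → inDegree v R ≡ 0
inDegree-∉ {v} R v∉R = cong length (filter-none (λ e → tgt e ≟ v) (tabulate λ e∈R tgt≡v →
  v∉R (subst (_∈ relLabels R) tgt≡v (tgt∈relLabels e∈R))))

inDegree-other : ∀ {v w u} R → u ≢ v → inDegree v ((w ≤' u) ∷ R) ≡ inDegree v R
inDegree-other {v} {w} {u} R u≢v =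
  cong length (filter-reject (λ e → tgt e ≟ v) {w ≤' u} {R} u≢v)

inDegree-new : ∀ {w u} R → inDegree u ((w ≤' u) ∷ R) ≡ 1 + inDegree u R
inDegree-new {w} {u} R = cong length (filter-accept (λ e → tgt e ≟ u) {w ≤' u} {R} refl)

IsTree-↭ : ∀ {R R'} → R ↭ R' → IsTree R → IsTree R'
IsTree-↭ {R} {R'} R↭R' (r , r∈ , r-root , indeg₁ , reach) =
  r , forth r∈ , trans (sym (inDegree-↭ r R↭R')) r-root ,
  (λ v v∈ v≢r → trans (sym (inDegree-↭ v R↭R')) (indeg₁ v (back v∈) v≢r)) ,
  (λ v v∈ → ⇝-mono (⊆-reflexive-↭ R↭R') (reach v (back v∈)))
  where
  forth : relLabels R ⊆ relLabels R'
  forth = relLabels-mono (⊆-reflexive-↭ R↭R')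
  back : relLabels R' ⊆ relLabels R
  back = relLabels-mono (⊆-reflexive-↭ (↭-sym R↭R'))

IsTree-edge : ∀ {w u} → u ≢ w → IsTree ((w ≤' u) ∷ [])
IsTree-edge {w} {u} u≢w =
  w , here refl , inDegree-other [] u≢w ,
  (λ { _ (here refl) v≢w → ⊥-elim (v≢w refl)
     ; _ (there (here refl)) _ → inDegree-new {w} {u} []
     ; _ (there (there ())) _ }) ,
  (λ { _ (here refl) → ⇝-refl
     ; _ (there (here refl)) → ⇝-step (here refl) ⇝-refl
     ; _ (there (there ())) })

IsTree-addLeaf : ∀ {R w u} → IsTree R → w ∈ relLabels R → u ∉ relLabels R →
  IsTree ((w ≤' u) ∷ R)
IsTree-addLeaf {R} {w} {u} (r , r∈ , r-root , indeg₁ , reach) w∈ u∉ =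
  r , there (there r∈) , trans (inDegree-other R (fresh r∈)) r-root ,
  (λ { v (here refl) v≢r → trans (inDegree-other R (fresh w∈)) (indeg₁ v w∈ v≢r)
     ; v (there (here refl)) _ → trans (inDegree-new R) (cong (1 +_) (inDegree-∉ R u∉))
     ; v (there (there v∈)) v≢r → trans (inDegree-other R (fresh v∈)) (indeg₁ v v∈ v≢r) }) ,
  (λ { v (here refl) → weaken (reach w w∈)
     ; v (there (here refl)) → ⇝-snoc (weaken (reach w w∈)) (here refl)
     ; v (there (there v∈)) → weaken (reach v v∈) })
  where
  fresh : ∀ {v} → v ∈ relLabels R → u ≢ v
  fresh v∈ refl = u∉ v∈
  weaken : ∀ {x y} → x ⇝[ R ] y → x ⇝[ (w ≤' u) ∷ R ] y
  weaken = ⇝-mono (xs⊆x∷xs R (w ≤' u))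

IsTreeSequent-↭ : ∀ {R R' Γ Γ' Δ Δ'} → R ↭ R' → Γ ↭ Γ' → Δ ↭ Δ' →
  IsTreeSequent ⟨ R , Γ ⇒ Δ ⟩ → IsTreeSequent ⟨ R' , Γ' ⇒ Δ' ⟩
IsTreeSequent-↭ {[]} {[]} _ Γ↭Γ' Δ↭Δ' (w , labels≡w) =
  w , anti-mono (++⁺ (⊆-reflexive-↭ (fmlLabels-↭ (↭-sym Γ↭Γ')))
                     (⊆-reflexive-↭ (fmlLabels-↭ (↭-sym Δ↭Δ')))) labels≡w
IsTreeSequent-↭ {[]} {_ ∷ _} R↭R' _ _ _ with () ← ↭-empty-inv (↭-sym R↭R')
IsTreeSequent-↭ {_ ∷ _} {[]} R↭R' _ _ _ with () ← ↭-empty-inv R↭R'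
IsTreeSequent-↭ {_ ∷ _} {_ ∷ _} R↭R' Γ↭Γ' Δ↭Δ' (tree , labels∈R) =
  IsTree-↭ R↭R' tree ,
  All.map (relLabels-mono (⊆-reflexive-↭ R↭R'))
    (anti-mono (++⁺ (⊆-reflexive-↭ (fmlLabels-↭ (↭-sym Γ↭Γ')))
                    (⊆-reflexive-↭ (fmlLabels-↭ (↭-sym Δ↭Δ')))) labels∈R)

IsTreeSequent-⊆ : ∀ {R Γ Δ Γ' Δ'} →
  formulaLabels ⟨ R , Γ' ⇒ Δ' ⟩ ⊆ formulaLabels ⟨ R , Γ ⇒ Δ ⟩ ++ relLabels R →
  IsTreeSequent ⟨ R , Γ ⇒ Δ ⟩ → IsTreeSequent ⟨ R , Γ' ⇒ Δ' ⟩
IsTreeSequent-⊆ {[]} labels'⊆ (w , labels≡w) =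
  w , anti-mono (⊆-trans labels'⊆ (⊆-reflexive (++-identityʳ _))) labels≡w
IsTreeSequent-⊆ {_ ∷ _} {Γ} {Δ} labels'⊆ (tree , labels∈R) =
  tree , tabulate ([ lookup labels∈R , (λ x∈R → x∈R) ]′ ∘ ∈-++⁻ (fmlLabels Γ ++ fmlLabels Δ) ∘ labels'⊆)

formulaLabels-⊆ : ∀ {R Γ Δ w} → IsTreeSequent ⟨ R , Γ ⇒ Δ ⟩ →
  w ∈ formulaLabels ⟨ R , Γ ⇒ Δ ⟩ → formulaLabels ⟨ R , Γ ⇒ Δ ⟩ ⊆ w ∷ relLabels R
formulaLabels-⊆ {[]} (_ , labels≡w') w∈ x∈ = here (trans (lookup labels≡w' x∈) (sym (lookup labels≡w' w∈)))
formulaLabels-⊆ {_ ∷ _} (_ , labels∈R) _ x∈ = there (lookup labels∈R x∈)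

⊃r-formulaLabels : ∀ {R Γ Δ w u A B} → IsTreeSequent ⟨ R , Γ ⇒ (w ∶ (A ⊃ B)) ∷ Δ ⟩ →
  formulaLabels ⟨ (w ≤' u) ∷ R , (u ∶ A) ∷ Γ ⇒ (u ∶ B) ∷ Δ ⟩ ⊆ relLabels ((w ≤' u) ∷ R)
⊃r-formulaLabels {R} {Γ} {Δ} {w} {u} t =
  insert-⊆ (u ∷ fmlLabels Γ) u∈ (∈-∷⁺ʳ u∈ (⊆-trans dropped (∷⁺ʳ w (xs⊆x∷xs (relLabels R) u))))
  where
  u∈ : u ∈ w ∷ u ∷ relLabels R
  u∈ = there (here refl)
  dropped : fmlLabels Γ ++ fmlLabels Δ ⊆ w ∷ relLabels R
  dropped = ⊆-trans (++⁺ʳ (fmlLabels Γ) (xs⊆x∷xs (fmlLabels Δ) w))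
                    (formulaLabels-⊆ t (∈-++⁺ʳ (fmlLabels Γ) (here refl)))

IsTreeSequent-⊃r : ∀ {R Γ Δ w u A B} →
  u ∉ seqLabels ⟨ R , Γ ⇒ (w ∶ (A ⊃ B)) ∷ Δ ⟩ →
  IsTreeSequent ⟨ R , Γ ⇒ (w ∶ (A ⊃ B)) ∷ Δ ⟩ →
  IsTreeSequent ⟨ (w ≤' u) ∷ R , (u ∶ A) ∷ Γ ⇒ (u ∶ B) ∷ Δ ⟩
IsTreeSequent-⊃r {[]} {Γ} {u = u} {A} {B} fresh t =
  IsTree-edge (λ { refl → fresh (∈-++⁺ʳ (fmlLabels Γ) (here refl)) }) ,
  tabulate (⊃r-formulaLabels {u = u} {A} {B} t)
IsTreeSequent-⊃r {_ ∷ _} {Γ} {u = u} {A} {B} fresh t@(tree , labels∈R) =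
  IsTree-addLeaf tree (lookup labels∈R (∈-++⁺ʳ (fmlLabels Γ) (here refl))) (fresh ∘ ∈-++⁺ˡ) ,
  tabulate (⊃r-formulaLabels {u = u} {A} {B} t)

IsTreeSequent⇒IsTreeDerivation : ∀ {S} → IsTreeSequent S → (d : L′IL S) → IsTreeDerivation d
IsTreeSequent⇒IsTreeDerivation t (perm R↭R' Γ↭Γ' Δ↭Δ' d) =
  t , IsTreeSequent⇒IsTreeDerivation (IsTreeSequent-↭ (↭-sym R↭R') (↭-sym Γ↭Γ') (↭-sym Δ↭Δ') t) d
IsTreeSequent⇒IsTreeDerivation t id = t
IsTreeSequent⇒IsTreeDerivation t ⊥l = t
IsTreeSequent⇒IsTreeDerivation t (r-id _) = t
IsTreeSequent⇒IsTreeDerivation t (⊃r fresh d) =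
  t , IsTreeSequent⇒IsTreeDerivation (IsTreeSequent-⊃r fresh t) d
IsTreeSequent⇒IsTreeDerivation t (∨l d e) =
  t , IsTreeSequent⇒IsTreeDerivation (IsTreeSequent-⊆ (xs⊆xs++ys _ _) t) d
    , IsTreeSequent⇒IsTreeDerivation (IsTreeSequent-⊆ (xs⊆xs++ys _ _) t) e
IsTreeSequent⇒IsTreeDerivation t (∧r d e) =
  t , IsTreeSequent⇒IsTreeDerivation (IsTreeSequent-⊆ (xs⊆xs++ys _ _) t) d
    , IsTreeSequent⇒IsTreeDerivation (IsTreeSequent-⊆ (xs⊆xs++ys _ _) t) e
IsTreeSequent⇒IsTreeDerivation {⟨ _ , Γ ⇒ _ ⟩} t (∨r d) =
  t , IsTreeSequent⇒IsTreeDerivation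
        (IsTreeSequent-⊆ (insert-⊆ (fmlLabels Γ) (∈-++⁺ˡ (∈-++⁺ʳ (fmlLabels Γ) (here refl))) (xs⊆xs++ys _ _)) t) d
IsTreeSequent⇒IsTreeDerivation t (∧l d) =
  t , IsTreeSequent⇒IsTreeDerivation (IsTreeSequent-⊆ (insert-⊆ [] (here refl) (xs⊆xs++ys _ _)) t) d
-- Here R is a cons, so IsTreeSequent computes and its implicit arguments cannot be inferred.
IsTreeSequent⇒IsTreeDerivation {⟨ R , Γ ⇒ Δ ⟩} t (⊃l {Γ = Γ₀} {w = w} {u} {A} {B} d e) =
  t , IsTreeSequent⇒IsTreeDerivation
        (IsTreeSequent-⊆ {R} {Γ} {Δ} {(w ∶ (A ⊃ B)) ∷ (u ∶ B) ∷ Γ₀} {Δ}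
          (insert-⊆ (w ∷ []) u∈ (xs⊆xs++ys _ _)) t) d
    , IsTreeSequent⇒IsTreeDerivation
        (IsTreeSequent-⊆ {R} {Γ} {Δ} {Γ} {(u ∶ A) ∷ Δ}
          (insert-⊆ (w ∷ fmlLabels Γ₀) u∈ (xs⊆xs++ys _ _)) t) e
  where
  u∈ : u ∈ formulaLabels ⟨ R , Γ ⇒ Δ ⟩ ++ relLabels R
  u∈ = ∈-++⁺ʳ (formulaLabels ⟨ R , Γ ⇒ Δ ⟩) (there (here refl))
IsTreeSequent⇒IsTreeDerivation {⟨ R , (w ∶ _) ∷ Γ ⇒ Δ ⟩} t (p⊃l {u = u} w⇝u d e) =
  t , IsTreeSequent⇒IsTreeDerivation (IsTreeSequent-⊆ (insert-⊆ (w ∷ fmlLabels Γ) u∈ (xs⊆xs++ys _ _)) t) d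
    , IsTreeSequent⇒IsTreeDerivation (IsTreeSequent-⊆ (insert-⊆ (w ∷ []) u∈ (xs⊆xs++ys _ _)) t) e
  where
  u∈ : u ∈ (w ∷ fmlLabels Γ ++ fmlLabels Δ) ++ relLabels R
  u∈ = ⇝-closed (w ∷ fmlLabels Γ ++ fmlLabels Δ) w⇝u (here refl)

lemma3p16 : (A : Formula) (w : Label) (d : L′IL ⟨ [] , [] ⇒ (w ∶ A) ∷ [] ⟩) →
    IsTreeDerivation d
lemma3p16 A w d = IsTreeSequent⇒IsTreeDerivation (w , refl ∷ []) d
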